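{- For each $m\ge 1$, the set $B(K_{1,m};132)$ consists of exactly one permutation, namely $$(2m-1)\,(2m)\,(2m-3)\,(2m-2)\,\cdots\,3\,4\,1\,2\,(2m+1)\in\mathcal{S}_{2m+1}.$$
   Context: For $\pi=\pi_1\cdots\pi_n\in\mathcal{S}_n$, the digraph $D(\pi)$ has vertices $1,\dots,n$ and an arc from $j$ to $i$ whenever $i<j$ and $\pi_i<\pi_j$. The weighted competition graph $W(\pi)$ is the edge-weighted simple graph on the same vertices in which distinct $u,v$ are joined by an edge iff they have a common out-neighbor in $D(\pi)$, with weight equal to the number of common out-neighbors. $K_{1,m}$ is the star with one center and $m$ leaves, all edge weights $1$. For an edge-weighted graph $G$ and a pattern $\tau$, $W_n^{ -1}(G;\tau)$ is the set of $\pi\in\mathcal{S}_n$ avoiding $\tau$ such that $W(\pi)$ is isomorphic, as an edge-weighted graph, to $G$ together with some number of isolated vertices. A term $\pi_i$ is an accessory term if it is not part of any occurrence of the pattern $123$ or $132$ in $\pi$ (equivalently, it is neither an endpoint of an edge of $W(\pi)$ nor a common out-neighbor inducing an edge). A base permutation is one with no accessory terms, and $B(G;\tau)$ is the set of base permutations in $\bigcup_n W_n^{ -1}(G;\tau)$. -}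

module Defs where

open import Data.Nat using (ℕ; zero; suc; _+_; _*_)
open import Data.Fin using (Fin; toℕ; _<_; _<?_)
open import Data.Fin.Permutation using (Permutation′; _⟨$⟩ʳ_)
open import Data.List using (List; []; _∷_; _++_; length; filter; map; allFin)
open import Data.Product using (Σ; ∃; ∃-syntax; _×_)
open import Data.Sum using (_⊎_)
open import Relation.Binary.PropositionalEquality using (_≡_; _≢_)
open import Relation.Nullary using (¬_)
open import Relation.Nullary.Decidable using (_×-dec_)

-- Positions are 0-indexed Fin n; values π_i are also Fin n (0-indexed).
-- Comparisons of positions/values use Fin's order (i.e. via toℕ).

module _ {n : ℕ} (π : Permutation′ n) where

  -- arc from j to i in D(π): i < j and π_i < π_j
  Arc : Fin n → Fin n → Set
  Arc j i = (i < j) × ((π ⟨$⟩ʳ i) < (π ⟨$⟩ʳ j))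

  -- number of common out-neighbours of u and v in D(π)
  weight : Fin n → Fin n → ℕ
  weight u v = length (filter (λ k → (k <? u ×-dec ((π ⟨$⟩ʳ k) <? (π ⟨$⟩ʳ u)))
                                      ×-dec (k <? v ×-dec ((π ⟨$⟩ʳ k) <? (π ⟨$⟩ʳ v))))
                              (allFin n))

  -- W(π) ≅ K_{1,m} together with isolated vertices (as edge-weighted graphs):
  -- there is a centre c and m distinct leaves L (all different from c) such that
  -- for distinct u v, the weight of {u,v} is 1 if {u,v} is a star edge and 0
  -- (no edge) otherwise.
  StarEdge : {m : ℕ} → Fin n → (Fin m → Fin n) → Fin n → Fin n → Set
  StarEdge c L u v = (u ≡ c × ∃[ ℓ ] L ℓ ≡ v) ⊎ (v ≡ c × ∃[ ℓ ] L ℓ ≡ u)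

  WIsStar : ℕ → Set
  WIsStar m = Σ (Fin n) λ c → Σ (Fin m → Fin n) λ L →
      (∀ a b → L a ≡ L b → a ≡ b)
    × (∀ a → L a ≢ c)
    × (∀ u v → u ≢ v →
          (StarEdge c L u v → weight u v ≡ 1)
        × (¬ StarEdge c L u v → weight u v ≡ 0))

  Avoids132 : Set
  Avoids132 = ∀ (i j k : Fin n) → i < j → j < k →
    ¬ (((π ⟨$⟩ʳ i) < (π ⟨$⟩ʳ k)) × ((π ⟨$⟩ʳ k) < (π ⟨$⟩ʳ j)))

  Occ123or132 : Fin n → Fin n → Fin n → Set
  Occ123or132 i j k = (i < j) × (j < k) ×
    ((((π ⟨$⟩ʳ i) < (π ⟨$⟩ʳ j)) × ((π ⟨$⟩ʳ j) < (π ⟨$⟩ʳ k)))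
     ⊎ (((π ⟨$⟩ʳ i) < (π ⟨$⟩ʳ k)) × ((π ⟨$⟩ʳ k) < (π ⟨$⟩ʳ j))))

  Accessory : Fin n → Set
  Accessory t = ¬ (∃[ i ] ∃[ j ] ∃[ k ] (Occ123or132 i j k × (t ≡ i ⊎ t ≡ j ⊎ t ≡ k)))

  IsBase : Set
  IsBase = ∀ t → ¬ Accessory t

  InB-Star132 : ℕ → Set
  InB-Star132 m = Avoids132 × WIsStar m × IsBase

  -- one-line notation of π with 1-indexed values π_1 ... π_n
  oneLine : List ℕ
  oneLine = map (λ i → suc (toℕ (π ⟨$⟩ʳ i))) (allFin n)

pairsDown : ℕ → List ℕ
pairsDown zero = []
pairsDown (suc k) = (1 + 2 * k) ∷ (2 + 2 * k) ∷ pairsDown k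

targetPerm : ℕ → List ℕ
targetPerm m = pairsDown m ++ ((1 + 2 * m) ∷ [])

module Submission where

-- We work with 0-indexed positions and values.  The target is then the map
-- `target m m` on positions 0 … 2m, whose ascents (p < q with a smaller value
-- at p) are exactly the pairs (2i, 2i+1) and (p, 2m)  (`target-ascent`).
-- Edge weights of W(π) are counts of common out-neighbours (`Counting`,
-- `Weights`).
--  (⇐) `TargetInB`: read off from the ascents, the target avoids 132, its
--      only pairs with a common out-neighbour are {2m, 2i+1}, sharing just
--      2i, and every position lies in an occurrence of 123 ending at 2m.
--  (⇒) `orient` puts all leaves of the star left of its centre c, and
--      `LeftStarAnalysis` shows that leaves and their partners alternate up
--      to c = 2m, and that π orders its positions as `target m m` does; a
--      strictly increasing self-map of {0, …, n-1} is the identity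
--      (`StrictlyIncreasing`), so the values coincide.

open import Data.Nat using (ℕ; zero; suc; _+_; _*_; ⌊_/2⌋; _≤_; _<_; _≥_; z≤n; s≤s; z<s; s<s; s≤s⁻¹)
open import Data.Nat.Properties
open import Data.Fin using (Fin; toℕ)
open import Data.Fin.Permutation using (Permutation′; _⟨$⟩ʳ_; _⟨$⟩ˡ_; inverseˡ; inverseʳ)
open import Defs
import Data.Fin as F
import Data.Fin.Properties as FP
open import Data.List using ([]; _∷_; _++_; length; filter; tabulate)
open import Data.List.Properties
  using (filter-none; filter-some; filter-accept; filter-reject; ∷-injective; map-tabulate; length-tabulate; tabulate-cong)
import Data.List.Relation.Unary.All.Properties as All
import Data.List.Relation.Unary.Any.Properties as Any
open import Data.Product using (Σ; ∃; ∃-syntax; _×_; _,_; proj₁; proj₂; swap)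
open import Data.Sum using (_⊎_; inj₁; inj₂)
open import Data.Empty using (⊥; ⊥-elim)
open import Data.Unit using (⊤; tt)
open import Function using (_∘_)
open import Function.Bundles using (_⇔_; mk⇔)
open import Relation.Binary.PropositionalEquality
open import Relation.Binary.Definitions using (tri<; tri≈; tri>)
open import Relation.Nullary using (¬_; Dec; yes; no; contradiction)
open import Relation.Nullary.Decidable using (_×-dec_; _⊎-dec_; decidable-stable)
open import Relation.Unary using (Pred; Decidable)

module Counting {a p} {A : Set a} {P : Pred A p} (P? : Decidable P) where

  count : ∀ {n} → (Fin n → A) → ℕ
  count f = length (filter P? (tabulate f))

  count-none : ∀ {n} (f : Fin n → A) → (∀ i → ¬ P (f i)) → count f ≡ 0
  count-none f none = cong length (filter-none P? (All.tabulate⁺ none))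

  count-some : ∀ {n} (f : Fin n → A) i → P (f i) → 0 < count f
  count-some f i pi = filter-some P? (Any.tabulate⁺ i pi)

  count-unique : ∀ {n} (f : Fin n → A) i → P (f i) → (∀ j → P (f j) → j ≡ i) → count f ≡ 1
  count-unique {suc n} f F.zero pi only =
    trans (cong length (filter-accept P? pi))
          (cong suc (count-none (f ∘ F.suc) (λ j pj → FP.0≢1+n (sym (only (F.suc j) pj)))))
  count-unique {suc n} f (F.suc i) pi only =
    trans (cong length (filter-reject P? (λ p0 → FP.0≢1+n (only F.zero p0))))
          (count-unique (f ∘ F.suc) i pi (λ j pj → FP.suc-injective (only (F.suc j) pj)))

  count-tail : ∀ {n} (f : Fin (suc n) → A) → count (f ∘ F.suc) ≤ count f
  count-tail f with P? (f F.zero)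
  ... | yes _ = n≤1+n _
  ... | no _ = ≤-refl

  count-two : ∀ {n} (f : Fin n → A) i j → i ≢ j → P (f i) → P (f j) → 2 ≤ count f
  count-two f F.zero F.zero i≢j _ _ = ⊥-elim (i≢j refl)
  count-two f F.zero (F.suc j) _ pi pj =
    ≤-trans (s≤s (count-some (f ∘ F.suc) j pj)) (≤-reflexive (sym (cong length (filter-accept P? pi))))
  count-two f (F.suc i) F.zero _ pi pj =
    ≤-trans (s≤s (count-some (f ∘ F.suc) i pi)) (≤-reflexive (sym (cong length (filter-accept P? pj))))
  count-two f (F.suc i) (F.suc j) i≢j pi pj =
    ≤-trans (count-two (f ∘ F.suc) i j (i≢j ∘ cong F.suc) pi pj) (count-tail f)

-- Parity and doubling, by recursion so that they compute on 2k, 2k+1, 2k+2.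
Odd : ℕ → Set
Odd zero = ⊥
Odd (suc zero) = ⊤
Odd (suc (suc n)) = Odd n

odd? : ∀ n → Dec (Odd n)
odd? zero = no (λ ())
odd? (suc zero) = yes tt
odd? (suc (suc n)) = odd? n

dbl : ℕ → ℕ
dbl zero = zero
dbl (suc k) = suc (suc (dbl k))

odd-dbl+1 : ∀ k → Odd (suc (dbl k))
odd-dbl+1 zero = tt
odd-dbl+1 (suc k) = odd-dbl+1 k

¬odd-dbl : ∀ k → ¬ Odd (dbl k)
¬odd-dbl zero ()
¬odd-dbl (suc k) = ¬odd-dbl k

¬odd⇒odd-suc : ∀ t → ¬ Odd t → Odd (suc t)
¬odd⇒odd-suc zero _ = tt
¬odd⇒odd-suc (suc zero) ¬odd = ⊥-elim (¬odd tt)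
¬odd⇒odd-suc (suc (suc t)) ¬odd = ¬odd⇒odd-suc t ¬odd

odd⇒¬odd-suc : ∀ t → Odd t → ¬ Odd (suc t)
odd⇒¬odd-suc (suc zero) _ ()
odd⇒¬odd-suc (suc (suc t)) odd = odd⇒¬odd-suc t odd

odd⇒dbl+1 : ∀ x → Odd x → x ≡ suc (dbl ⌊ x /2⌋)
odd⇒dbl+1 (suc zero) _ = refl
odd⇒dbl+1 (suc (suc x)) odd = cong (suc ∘ suc) (odd⇒dbl+1 x odd)

dbl+1≢dbl : ∀ a b → suc (dbl a) ≢ dbl b
dbl+1≢dbl a b e = ¬odd-dbl b (subst Odd e (odd-dbl+1 a))

⌊dbl/2⌋ : ∀ k → ⌊ dbl k /2⌋ ≡ k
⌊dbl/2⌋ zero = refl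
⌊dbl/2⌋ (suc k) = cong suc (⌊dbl/2⌋ k)

dbl-injective : ∀ {a b} → dbl a ≡ dbl b → a ≡ b
dbl-injective {a} {b} e = trans (sym (⌊dbl/2⌋ a)) (trans (cong ⌊_/2⌋ e) (⌊dbl/2⌋ b))

dbl-mono-< : ∀ {a b} → a < b → dbl a < dbl b
dbl-mono-< {zero} {suc b} _ = z<s
dbl-mono-< {suc a} {suc b} (s<s a<b) = s<s (s<s (dbl-mono-< a<b))

dbl-mono-≤ : ∀ {a b} → a ≤ b → dbl a ≤ dbl b
dbl-mono-≤ {zero} _ = z≤n
dbl-mono-≤ {suc a} {suc b} (s≤s a≤b) = s≤s (s≤s (dbl-mono-≤ a≤b))

dbl-cancel-< : ∀ {a b} → dbl a < dbl b → a < b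
dbl-cancel-< {a} {b} da<db with <-cmp a b
... | tri< a<b _ _ = a<b
... | tri≈ _ refl _ = ⊥-elim (<-irrefl refl da<db)
... | tri> _ _ b<a = ⊥-elim (<-asym da<db (dbl-mono-< b<a))

dbl≡2* : ∀ k → dbl k ≡ 2 * k
dbl≡2* zero = refl
dbl≡2* (suc k) = cong suc (trans (cong suc (dbl≡2* k)) (sym (+-suc k (k + 0))))

-- The 0-indexed values of the target permutation: k descending pairs
-- (2k-2)(2k-1) … 2 3 0 1 followed by the value 2m at position 2k.
-- The theorem needs k = m; the two parameters separate for the induction.
target : ℕ → ℕ → ℕ → ℕ
target zero m _ = dbl m
target (suc k) m zero = dbl k
target (suc k) m (suc zero) = suc (dbl k)
target (suc k) m (suc (suc p)) = target k m p

target-< : ∀ k m p → p < dbl k → target k m p < dbl k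
target-< (suc k) m zero _ = ≤-trans (n<1+n _) (n≤1+n _)
target-< (suc k) m (suc zero) _ = n<1+n _
target-< (suc k) m (suc (suc p)) (s<s (s<s p<2k)) = m<n⇒m<1+n (m<n⇒m<1+n (target-< k m p p<2k))

target-last : ∀ k m → target k m (dbl k) ≡ dbl m
target-last zero m = refl
target-last (suc k) m = target-last k m

target-≤ : ∀ k m p → k ≤ m → p ≤ dbl k → target k m p ≤ dbl m
target-≤ k m p k≤m p≤2k with m≤n⇒m<n∨m≡n p≤2k
... | inj₁ p<2k = ≤-trans (<⇒≤ (target-< k m p p<2k)) (dbl-mono-≤ k≤m)
... | inj₂ refl = ≤-reflexive (target-last k m)

Ascent : ℕ → ℕ → ℕ → Set
Ascent k p q = (q ≡ dbl k) ⊎ (Odd q × q ≡ suc p)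

target-ascent : ∀ k m p q → k ≤ m → p < q → q ≤ dbl k →
  (Ascent k p q × target k m p < target k m q) ⊎ (¬ Ascent k p q × target k m q < target k m p)
target-ascent zero m p q _ p<q z≤n = ⊥-elim (n≮0 p<q)
target-ascent (suc k) m zero (suc zero) _ _ _ = inj₁ (inj₂ (tt , refl) , n<1+n _)
target-ascent (suc k) m zero (suc (suc q)) k≤m _ (s≤s (s≤s q≤2k)) with m≤n⇒m<n∨m≡n q≤2k
... | inj₂ refl = inj₁ (inj₁ refl , subst (dbl k <_) (sym (target-last k m)) (dbl-mono-< k≤m))
... | inj₁ q<2k = inj₂ (not-ascent , target-< k m q q<2k)
  where not-ascent : ¬ Ascent (suc k) zero (suc (suc q))
        not-ascent (inj₁ e) = <-irrefl (suc-injective (suc-injective e)) q<2k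
        not-ascent (inj₂ (_ , ()))
target-ascent (suc k) m (suc zero) (suc zero) _ (s<s ()) _
target-ascent (suc k) m (suc zero) (suc (suc q)) k≤m _ (s≤s (s≤s q≤2k)) with m≤n⇒m<n∨m≡n q≤2k
... | inj₂ refl = inj₁ (inj₁ refl , subst (suc (dbl k) <_) (sym (target-last k m)) (dbl-mono-≤ k≤m))
... | inj₁ q<2k = inj₂ (not-ascent , m≤n⇒m≤1+n (target-< k m q q<2k))
  where not-ascent : ¬ Ascent (suc k) (suc zero) (suc (suc q))
        not-ascent (inj₁ e) = <-irrefl (suc-injective (suc-injective e)) q<2k
        not-ascent (inj₂ (odd , refl)) = odd
target-ascent (suc k) m (suc (suc p)) (suc (suc q)) k≤m (s<s (s<s p<q)) (s≤s (s≤s q≤2k))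
  with target-ascent k m p q (≤-trans (n≤1+n k) k≤m) p<q q≤2k
... | inj₁ (asc , lt) = inj₁ (shift asc , lt)
  where shift : Ascent k p q → Ascent (suc k) (suc (suc p)) (suc (suc q))
        shift (inj₁ e) = inj₁ (cong (suc ∘ suc) e)
        shift (inj₂ (odd , e)) = inj₂ (odd , cong (suc ∘ suc) e)
... | inj₂ (¬asc , lt) = inj₂ (¬asc ∘ unshift , lt)
  where unshift : Ascent (suc k) (suc (suc p)) (suc (suc q)) → Ascent k p q
        unshift (inj₁ e) = inj₁ (suc-injective (suc-injective e))
        unshift (inj₂ (odd , e)) = inj₂ (odd , suc-injective (suc-injective e))

-- A strictly increasing map from {0, …, n-1} to itself is the identity: it
-- climbs at least one step at a time, and has no room to climb more.
module StrictlyIncreasing (n : ℕ) (g : ∀ x → x < n → ℕ) (g<n : ∀ x x<n → g x x<n < n)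
       (increasing : ∀ x y x<n y<n → x < y → g x x<n < g y y<n) where

  climbs : ∀ x x<n → x ≤ g x x<n
  climbs zero _ = z≤n
  climbs (suc x) sx<n = ≤-trans (s≤s (climbs x x<n)) (increasing x (suc x) x<n sx<n (n<1+n x))
    where x<n = <-trans (n<1+n x) sx<n

  spreads : ∀ d x x<n dx<n → g x x<n + d ≤ g (d + x) dx<n
  spreads zero x x<n x<n′ = ≤-reflexive (trans (+-identityʳ _) (cong (g x) (<-irrelevant x<n x<n′)))
  spreads (suc d) x x<n sdx<n = begin
      g x x<n + suc d          ≡⟨ +-suc (g x x<n) d ⟩
      suc (g x x<n + d)        ≤⟨ s≤s (spreads d x x<n dx<n) ⟩
      suc (g (d + x) dx<n)     ≤⟨ increasing (d + x) (suc d + x) dx<n sdx<n (n<1+n _) ⟩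
      g (suc d + x) sdx<n      ∎
    where open ≤-Reasoning
          dx<n = <-trans (n<1+n _) sdx<n

  identity : ∀ x x<n → g x x<n ≡ x
  identity x x<n with m≤n⇒∃[o]m+o≡n x<n
  ... | d , sx+d≡n = ≤-antisym (+-cancelʳ-≤ d (g x x<n) x (s≤s⁻¹ gx+d<sx+d)) (climbs x x<n)
    where
      dx<n : d + x < n
      dx<n = subst (d + x <_) (trans (cong suc (+-comm d x)) sx+d≡n) (n<1+n _)
      gx+d<sx+d : g x x<n + d < suc x + d
      gx+d<sx+d = subst (g x x<n + d <_) (sym sx+d≡n) (≤-trans (s≤s (spreads d x x<n dx<n)) (g<n _ dx<n))

value : ∀ {n} → Permutation′ n → Fin n → ℕ
value π i = toℕ (π ⟨$⟩ʳ i)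

-- the position x < n; the bound is irrelevant, so positions with equal
-- numbers are definitionally equal
at : ∀ {n} x → .(x < n) → Fin n
at x x<n = F.fromℕ< x<n

pos-at : ∀ {n} x .(x<n : x < n) → toℕ (at x x<n) ≡ x
pos-at x x<n = FP.toℕ-fromℕ< x<n

at-pos : ∀ {n} (t : Fin n) → at (toℕ t) (FP.toℕ<n t) ≡ t
at-pos t = FP.fromℕ<-toℕ t (FP.toℕ<n t)

value-injective : ∀ {n} (π : Permutation′ n) {i j} → value π i ≡ value π j → i ≡ j
value-injective π {i} {j} e = begin
    i                         ≡˘⟨ inverseˡ π ⟩
    π ⟨$⟩ˡ (π ⟨$⟩ʳ i)         ≡⟨ cong (π ⟨$⟩ˡ_) (FP.toℕ-injective e) ⟩
    π ⟨$⟩ˡ (π ⟨$⟩ʳ j)         ≡⟨ inverseˡ π ⟩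
    j                         ∎
  where open ≡-Reasoning

tabulate-injective : ∀ {n} {A : Set} (f g : Fin n → A) → tabulate f ≡ tabulate g → ∀ i → f i ≡ g i
tabulate-injective {suc n} f g e F.zero = proj₁ (∷-injective e)
tabulate-injective {suc n} f g e (F.suc i) =
  tabulate-injective (f ∘ F.suc) (g ∘ F.suc) (proj₂ (∷-injective e)) i

oneLine-tabulate : ∀ {n} (π : Permutation′ n) → oneLine π ≡ tabulate (suc ∘ value π)
oneLine-tabulate π = map-tabulate (λ i → i) _

targetPerm-tabulate : ∀ k m →
  pairsDown k ++ (1 + 2 * m ∷ []) ≡ tabulate {n = suc (dbl k)} (suc ∘ target k m ∘ toℕ)
targetPerm-tabulate zero m = cong (λ v → suc v ∷ []) (sym (dbl≡2* m))
targetPerm-tabulate (suc k) m = cong₂ _∷_ (cong suc (sym (dbl≡2* k)))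
  (cong₂ _∷_ (cong (suc ∘ suc) (sym (dbl≡2* k))) (targetPerm-tabulate k m))

oneLine-size : ∀ m {n} (π : Permutation′ n) → oneLine π ≡ targetPerm m → n ≡ suc (dbl m)
oneLine-size m π eq = begin
    _                                            ≡˘⟨ length-tabulate (suc ∘ value π) ⟩
    length (tabulate (suc ∘ value π))            ≡⟨ cong length (trans (sym (oneLine-tabulate π)) eq) ⟩
    length (targetPerm m)                        ≡⟨ cong length (targetPerm-tabulate m m) ⟩
    length (tabulate (suc ∘ target m m ∘ toℕ {suc (dbl m)}))
                                                 ≡⟨ length-tabulate (suc ∘ target m m ∘ toℕ {suc (dbl m)}) ⟩
    suc (dbl m)                                  ∎
  where open ≡-Reasoning

oneLine⇒values : ∀ m {n} (π : Permutation′ n) → oneLine π ≡ targetPerm m →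
  ∀ i → value π i ≡ target m m (toℕ i)
oneLine⇒values m π eq i with oneLine-size m π eq
... | refl = suc-injective (tabulate-injective (suc ∘ value π) (suc ∘ target m m ∘ toℕ) tabulated i)
  where tabulated = trans (sym (oneLine-tabulate π)) (trans eq (targetPerm-tabulate m m))

values⇒oneLine : ∀ m {n} (π : Permutation′ n) → n ≡ suc (dbl m) →
  (∀ i → value π i ≡ target m m (toℕ i)) → oneLine π ≡ targetPerm m
values⇒oneLine m π refl hv = trans (oneLine-tabulate π)
  (trans (tabulate-cong (cong suc ∘ hv)) (sym (targetPerm-tabulate m m)))

module Weights {n : ℕ} (π : Permutation′ n) where

  CommonOut : Fin n → Fin n → Fin n → Set
  CommonOut u v k = Arc π u k × Arc π v k

  commonOut? : ∀ u v → Decidable (CommonOut u v)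
  commonOut? u v k = (k F.<? u ×-dec (π ⟨$⟩ʳ k) F.<? (π ⟨$⟩ʳ u))
                 ×-dec (k F.<? v ×-dec (π ⟨$⟩ʳ k) F.<? (π ⟨$⟩ʳ v))

  module _ (u v : Fin n) where
    open Counting (commonOut? u v)

    weight-zero : (∀ k → ¬ CommonOut u v k) → weight π u v ≡ 0
    weight-zero = count-none (λ k → k)

    weight-one : ∀ k → CommonOut u v k → (∀ j → CommonOut u v j → j ≡ k) → weight π u v ≡ 1
    weight-one = count-unique (λ k → k)

    weight-positive : ∀ k → CommonOut u v k → 0 < weight π u v
    weight-positive = count-some (λ k → k)

    weight-one-unique : weight π u v ≡ 1 → ∀ j k → CommonOut u v j → CommonOut u v k → j ≡ k
    weight-one-unique w≡1 j k oj ok with j FP.≟ k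
    ... | yes j≡k = j≡k
    ... | no j≢k = contradiction (≤-trans (count-two (λ k → k) j k j≢k oj ok) (≤-reflexive w≡1))
                                 (<-irrefl refl)

    weight-one-exists : weight π u v ≡ 1 → ∃ (CommonOut u v)
    weight-one-exists w≡1 with FP.any? (commonOut? u v)
    ... | yes found = found
    ... | no none = contradiction (trans (sym w≡1) (weight-zero (λ k ok → none (k , ok)))) 1+n≢0

  commonOut-sym : ∀ {u v k} → CommonOut u v k → CommonOut v u k
  commonOut-sym = swap

-- The target permutation (of size 2m+1) lies in B(K_{1,m}; 132): its only
-- ascents are (2i, 2i+1) and (p, 2m), so it avoids 132; the common
-- out-neighbours of u and v exist only for {u, v} = {2m, 2i+1}, and then
-- 2i is the unique one, so W is the star with centre 2m and leaves 2i+1;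
-- finally every position lies in an occurrence of 123 ending at 2m.
module TargetInB (m : ℕ) (m≥1 : 1 ≤ m) (π : Permutation′ (suc (dbl m)))
                 (values : ∀ i → value π i ≡ target m m (toℕ i)) where
  open Weights π

  N : ℕ
  N = suc (dbl m)

  pos≤2m : ∀ (i : Fin N) → toℕ i ≤ dbl m
  pos≤2m i = s≤s⁻¹ (FP.toℕ<n i)

  below⇒ascent : ∀ (k u : Fin N) → k F.< u → value π k < value π u → Ascent m (toℕ k) (toℕ u)
  below⇒ascent k u k<u below with target-ascent m m (toℕ k) (toℕ u) ≤-refl k<u (pos≤2m u)
  ... | inj₁ (asc , _) = asc
  ... | inj₂ (_ , above) = contradiction below (<-asym (subst₂ _<_ (sym (values u)) (sym (values k)) above))

  ascent⇒below : ∀ (k u : Fin N) → k F.< u → Ascent m (toℕ k) (toℕ u) → value π k < value π u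
  ascent⇒below k u k<u asc with target-ascent m m (toℕ k) (toℕ u) ≤-refl k<u (pos≤2m u)
  ... | inj₁ (_ , below) = subst₂ _<_ (sym (values k)) (sym (values u)) below
  ... | inj₂ (¬asc , _) = contradiction asc ¬asc

  -- an ascent (i, k) with k = i+1 leaves no room for a middle term, and
  -- one with k = 2m makes every middle term smaller than π_k
  avoids : Avoids132 π
  avoids i j k i<j j<k (ik , kj) with below⇒ascent i k (<-trans i<j j<k) ik
  ... | inj₁ k-last = <-asym kj (ascent⇒below j k j<k (inj₁ k-last))
  ... | inj₂ (_ , k≡1+i) = <-irrefl refl (≤-trans (subst (toℕ j <_) k≡1+i j<k) i<j)

  centre : Fin N
  centre = at (dbl m) (n<1+n (dbl m))

  pos-centre : toℕ centre ≡ dbl m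
  pos-centre = pos-at (dbl m) (n<1+n (dbl m))

  is-centre : ∀ (u : Fin N) → toℕ u ≡ dbl m → u ≡ centre
  is-centre u e = FP.toℕ-injective (trans e (sym pos-centre))

  leaf : Fin m → Fin N
  leaf ℓ = at (suc (dbl (toℕ ℓ))) (s<s (dbl-mono-< (FP.toℕ<n ℓ)))

  pos-leaf : ∀ ℓ → toℕ (leaf ℓ) ≡ suc (dbl (toℕ ℓ))
  pos-leaf ℓ = pos-at _ (s<s (dbl-mono-< (FP.toℕ<n ℓ)))

  partner : Fin m → Fin N
  partner ℓ = at (dbl (toℕ ℓ)) (m≤n⇒m≤1+n (dbl-mono-< (FP.toℕ<n ℓ)))

  pos-partner : ∀ ℓ → toℕ (partner ℓ) ≡ dbl (toℕ ℓ)
  pos-partner ℓ = pos-at _ (m≤n⇒m≤1+n (dbl-mono-< (FP.toℕ<n ℓ)))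

  leaf-injective : ∀ a b → leaf a ≡ leaf b → a ≡ b
  leaf-injective a b e = FP.toℕ-injective (dbl-injective (suc-injective
    (trans (sym (pos-leaf a)) (trans (cong toℕ e) (pos-leaf b)))))

  leaf≢centre : ∀ a → leaf a ≢ centre
  leaf≢centre a e = dbl+1≢dbl (toℕ a) m (trans (sym (pos-leaf a)) (trans (cong toℕ e) pos-centre))

  odd⇒leaf : ∀ (x : Fin N) → Odd (toℕ x) → Σ (Fin m) λ ℓ → leaf ℓ ≡ x
  odd⇒leaf x odd = ℓ , FP.toℕ-injective (begin
      toℕ (leaf ℓ)                ≡⟨ pos-leaf ℓ ⟩
      suc (dbl (toℕ ℓ))           ≡⟨ cong (suc ∘ dbl) (pos-at _ half<m) ⟩
      suc (dbl ⌊ toℕ x /2⌋)       ≡˘⟨ odd⇒dbl+1 (toℕ x) odd ⟩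
      toℕ x                       ∎)
    where
      open ≡-Reasoning
      x<2m : toℕ x < dbl m
      x<2m = ≤∧≢⇒< (pos≤2m x) (λ e → ¬odd-dbl m (subst Odd e odd))
      half<m : ⌊ toℕ x /2⌋ < m
      half<m = dbl-cancel-< (≤-trans (n≤1+n _) (subst (_< dbl m) (odd⇒dbl+1 (toℕ x) odd) x<2m))
      ℓ : Fin m
      ℓ = at _ half<m

  partner<centre : ∀ ℓ → partner ℓ F.< centre
  partner<centre ℓ = subst₂ _<_ (sym (pos-partner ℓ)) (sym pos-centre) (dbl-mono-< (FP.toℕ<n ℓ))

  partner<leaf : ∀ ℓ → partner ℓ F.< leaf ℓ
  partner<leaf ℓ = subst₂ _<_ (sym (pos-partner ℓ)) (sym (pos-leaf ℓ)) (n<1+n _)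

  leaf-after-partner : ∀ ℓ → Ascent m (toℕ (partner ℓ)) (toℕ (leaf ℓ))
  leaf-after-partner ℓ = inj₂ (subst Odd (sym (pos-leaf ℓ)) (odd-dbl+1 (toℕ ℓ)) ,
                               trans (pos-leaf ℓ) (cong suc (sym (pos-partner ℓ))))

  partner-out : ∀ ℓ → CommonOut centre (leaf ℓ) (partner ℓ)
  partner-out ℓ = (partner<centre ℓ , ascent⇒below _ _ (partner<centre ℓ) (inj₁ pos-centre)) ,
                  (partner<leaf ℓ , ascent⇒below _ _ (partner<leaf ℓ) (leaf-after-partner ℓ))

  partner-unique : ∀ ℓ j → CommonOut centre (leaf ℓ) j → j ≡ partner ℓ
  partner-unique ℓ j (_ , (j<ℓ , below)) with below⇒ascent j (leaf ℓ) j<ℓ below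
  ... | inj₁ ℓ-last = contradiction (trans (sym (pos-leaf ℓ)) ℓ-last) (dbl+1≢dbl (toℕ ℓ) m)
  ... | inj₂ (_ , e) = FP.toℕ-injective (suc-injective
          (trans (sym e) (trans (pos-leaf ℓ) (cong suc (sym (pos-partner ℓ))))))

  commonOut⇒edge : ∀ u v → u ≢ v → ∀ j → CommonOut u v j → StarEdge π centre leaf u v
  commonOut⇒edge u v u≢v j ((j<u , ju) , (j<v , jv))
    with below⇒ascent j u j<u ju | below⇒ascent j v j<v jv
  ... | inj₁ eu | inj₁ ev = contradiction (FP.toℕ-injective (trans eu (sym ev))) u≢v
  ... | inj₁ eu | inj₂ (odd , _) = inj₁ (is-centre u eu , odd⇒leaf v odd)
  ... | inj₂ (odd , _) | inj₁ ev = inj₂ (is-centre v ev , odd⇒leaf u odd)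
  ... | inj₂ (_ , eu) | inj₂ (_ , ev) = contradiction (FP.toℕ-injective (trans eu (sym ev))) u≢v

  edge-weight : ∀ u v → StarEdge π centre leaf u v → weight π u v ≡ 1
  edge-weight u v (inj₁ (refl , ℓ , refl)) =
    weight-one centre (leaf ℓ) (partner ℓ) (partner-out ℓ) (partner-unique ℓ)
  edge-weight u v (inj₂ (refl , ℓ , refl)) =
    weight-one (leaf ℓ) centre (partner ℓ) (commonOut-sym (partner-out ℓ))
               (λ j oj → partner-unique ℓ j (commonOut-sym oj))

  star : WIsStar π m
  star = centre , leaf , leaf-injective , leaf≢centre , λ u v u≢v →
    edge-weight u v ,
    λ ¬edge → weight-zero u v (λ j oj → ¬edge (commonOut⇒edge u v u≢v j oj))

  pair-occurrence : ∀ (p q : Fin N) → toℕ q ≡ suc (toℕ p) → Odd (toℕ q) → Occ123or132 π p q centre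
  pair-occurrence p q q≡1+p odd =
    p<q , q<c , inj₁ (ascent⇒below p q p<q (inj₂ (odd , q≡1+p)) ,
                      ascent⇒below q centre q<c (inj₁ pos-centre))
    where
      p<q : p F.< q
      p<q = subst (toℕ p <_) (sym q≡1+p) (n<1+n _)
      q<c : q F.< centre
      q<c = subst (toℕ q <_) (sym pos-centre) (≤∧≢⇒< (pos≤2m q) (λ e → ¬odd-dbl m (subst Odd e odd)))

  -- an odd position is the middle of (t-1, t, 2m), the last one the end of
  -- (0, 1, 2m), and any other even position the start of (t, t+1, 2m)
  base : IsBase π
  base t accessory with odd? (toℕ t)
  ... | yes odd = accessory (p , t , centre , pair-occurrence p t t≡1+p odd , inj₂ (inj₁ refl))
    where
      p<N : dbl ⌊ toℕ t /2⌋ < N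
      p<N = ≤-trans (n≤1+n _) (subst (_< N) (odd⇒dbl+1 (toℕ t) odd) (FP.toℕ<n t))
      p = at _ p<N
      t≡1+p : toℕ t ≡ suc (toℕ p)
      t≡1+p = trans (odd⇒dbl+1 (toℕ t) odd) (cong suc (sym (pos-at _ p<N)))
  ... | no even with toℕ t ≟ dbl m
  ...   | yes t-last = accessory (zero′ , one′ , centre , pair-occurrence zero′ one′ one≡1+zero one-odd ,
                                  inj₂ (inj₂ (is-centre t t-last)))
    where
      1<N : 1 < N
      1<N = s≤s (≤-trans (n≤1+n 1) (dbl-mono-≤ m≥1))
      zero′ = at 0 (<-trans z<s 1<N)
      one′ = at 1 1<N
      one-odd : Odd (toℕ one′)
      one-odd = subst Odd (sym (pos-at 1 1<N)) tt
      one≡1+zero : toℕ one′ ≡ suc (toℕ zero′)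
      one≡1+zero = trans (pos-at 1 1<N) (cong suc (sym (pos-at 0 (<-trans z<s 1<N))))
  ...   | no t-not-last = accessory (t , q , centre , pair-occurrence t q (pos-at _ q<N) q-odd , inj₁ refl)
    where
      q<N : suc (toℕ t) < N
      q<N = s<s (≤∧≢⇒< (pos≤2m t) t-not-last)
      q = at _ q<N
      q-odd : Odd (toℕ q)
      q-odd = subst Odd (sym (pos-at _ q<N)) (¬odd⇒odd-suc (toℕ t) even)

  inB : InB-Star132 π m
  inB = avoids , star , base

StarEdges : ∀ {n} (π : Permutation′ n) {m} → Fin n → (Fin m → Fin n) → Set
StarEdges π c L = ∀ u v → u ≢ v →
  (StarEdge π c L u v → weight π u v ≡ 1) × (¬ StarEdge π c L u v → weight π u v ≡ 0)

module StarFacts {n : ℕ} (π : Permutation′ n) (avoid : Avoids132 π) {m : ℕ}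
       (c : Fin n) (L : Fin m → Fin n) (L≢c : ∀ a → L a ≢ c) (edges : StarEdges π c L) where
  open Weights π public

  Leaf : Fin n → Set
  Leaf q = Σ (Fin m) λ ℓ → L ℓ ≡ q

  leaf≢centre : ∀ {q} → Leaf q → q ≢ c
  leaf≢centre (ℓ , refl) = L≢c ℓ

  starEdge? : ∀ u v → Dec (StarEdge π c L u v)
  starEdge? u v = ((u FP.≟ c) ×-dec FP.any? (λ ℓ → L ℓ FP.≟ v))
             ⊎-dec ((v FP.≟ c) ×-dec FP.any? (λ ℓ → L ℓ FP.≟ u))

  edge⇒commonOut : ∀ u v → u ≢ v → StarEdge π c L u v → ∃ (CommonOut u v)
  edge⇒commonOut u v u≢v edge = weight-one-exists u v (proj₁ (edges u v u≢v) edge)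

  edge-commonOut-unique : ∀ u v → u ≢ v → StarEdge π c L u v →
    ∀ j k → CommonOut u v j → CommonOut u v k → j ≡ k
  edge-commonOut-unique u v u≢v edge = weight-one-unique u v (proj₁ (edges u v u≢v) edge)

  commonOut⇒edge : ∀ u v → u ≢ v → ∀ k → CommonOut u v k → StarEdge π c L u v
  commonOut⇒edge u v u≢v k ok with starEdge? u v
  ... | yes edge = edge
  ... | no ¬edge = contradiction (proj₂ (edges u v u≢v) ¬edge) (>⇒≢ (weight-positive u v k ok))

  -- two leaves have no common out-neighbour: every star edge contains c
  leaves-unjoined : ∀ {a b} → Leaf a → Leaf b → a ≢ b → ∀ k → ¬ CommonOut a b k
  leaves-unjoined la lb a≢b k ok with commonOut⇒edge _ _ a≢b k ok
  ... | inj₁ (a≡c , _) = leaf≢centre la a≡c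
  ... | inj₂ (b≡c , _) = leaf≢centre lb b≡c

  centreOut : ∀ {q} → Leaf q → ∃ (CommonOut c q)
  centreOut {q} lq = edge⇒commonOut c q (λ c≡q → leaf≢centre lq (sym c≡q)) (inj₁ (refl , lq))

  middle-below : ∀ {i j k} → i F.< j → j F.< k → value π i < value π k → value π j < value π k
  middle-below {i} {j} {k} i<j j<k ik with <-cmp (value π j) (value π k)
  ... | tri< jk _ _ = jk
  ... | tri≈ _ jk _ = contradiction (value-injective π jk) (FP.<⇒≢ j<k)
  ... | tri> _ _ kj = contradiction (ik , kj) (avoid i j k i<j j<k)

  leaf-right-above : ∀ {q} → Leaf q → c F.< q → value π c < value π q
  leaf-right-above lq c<q with centreOut lq
  ... | k , (k<c , _) , (_ , kq) = middle-below k<c c<q kq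

  leaf-left-below : ∀ {q} → Leaf q → q F.< c → value π q < value π c
  leaf-left-below lq q<c with centreOut lq
  ... | k , (_ , kc) , (k<q , _) = middle-below k<q q<c kc

  no-two-right-leaves : ∀ {a b} → Leaf a → Leaf b → c F.< a → ¬ a F.< b
  no-two-right-leaves {a} {b} la lb c<a a<b with <-cmp (value π a) (value π b)
  ... | tri≈ _ ab _ = FP.<⇒≢ a<b (value-injective π ab)
  ... | tri> _ _ ba = avoid c a b c<a a<b (leaf-right-above lb (<-trans c<a a<b) , ba)
  ... | tri< ab _ _ with centreOut la
  ...   | k , _ , (k<a , ka) = leaves-unjoined la lb (FP.<⇒≢ a<b) k
                                 ((k<a , ka) , (<-trans k<a a<b , <-trans ka ab))

  right-leaf-unique : ∀ {q₀} → Leaf q₀ → c F.< q₀ → ∀ {q} → Leaf q → q ≡ q₀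
  right-leaf-unique {q₀} l₀ c<q₀ {q} lq with FP.<-cmp q c
  ... | tri≈ _ q≡c _ = contradiction q≡c (leaf≢centre lq)
  ... | tri< q<c _ _ with centreOut lq
  ...   | k , _ , (k<q , kq) = contradiction ((k<q , kq) , (<-trans k<q q<q₀ , <-trans kq qq₀))
                                             (leaves-unjoined lq l₀ (FP.<⇒≢ q<q₀) k)
    where q<q₀ = <-trans q<c c<q₀
          qq₀ = <-trans (leaf-left-below lq q<c) (leaf-right-above l₀ c<q₀)
  right-leaf-unique {q₀} l₀ c<q₀ {q} lq | tri> _ _ c<q with FP.<-cmp q q₀
  ... | tri≈ _ q≡q₀ _ = q≡q₀
  ... | tri< q<q₀ _ _ = contradiction q<q₀ (no-two-right-leaves lq l₀ c<q)
  ... | tri> _ _ q₀<q = contradiction q₀<q (no-two-right-leaves l₀ lq c<q₀)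

record LeftStar {n : ℕ} (π : Permutation′ n) (m : ℕ) : Set where
  field
    centre : Fin n
    leaf : Fin m → Fin n
    leaf-injective : ∀ a b → leaf a ≡ leaf b → a ≡ b
    leaf≢centre : ∀ a → leaf a ≢ centre
    edges : StarEdges π centre leaf
    leaf<centre : ∀ a → leaf a F.< centre

-- Every star presentation can be taken with its leaves left of the centre:
-- a leaf q₀ to the right of c is the only leaf, so the star is the single
-- edge {c, q₀}, which we re-centre at q₀.
orient : ∀ {n} {π : Permutation′ n} {m} → Avoids132 π → WIsStar π m → LeftStar π m
orient {π = π} avoid (c , L , L-inj , L≢c , edges) with FP.any? (λ ℓ → c F.<? L ℓ)
... | no none-right = record
  { centre = c ; leaf = L ; leaf-injective = L-inj ; leaf≢centre = L≢c ; edges = edges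
  ; leaf<centre = left }
  where
    left : ∀ ℓ → L ℓ F.< c
    left ℓ with FP.<-cmp (L ℓ) c
    ... | tri< ℓ<c _ _ = ℓ<c
    ... | tri≈ _ ℓ≡c _ = contradiction ℓ≡c (L≢c ℓ)
    ... | tri> _ _ c<ℓ = contradiction (ℓ , c<ℓ) none-right
... | yes (ℓ₀ , c<q₀) = record
  { centre = L ℓ₀ ; leaf = λ _ → c
  ; leaf-injective = λ a b _ → L-inj a b (trans (only-leaf a) (sym (only-leaf b)))
  ; leaf≢centre = λ _ → FP.<⇒≢ c<q₀ ; edges = edges′ ; leaf<centre = λ _ → c<q₀ }
  where
    open StarFacts π avoid c L L≢c edges
    only-leaf : ∀ ℓ → L ℓ ≡ L ℓ₀
    only-leaf ℓ = right-leaf-unique (ℓ₀ , refl) c<q₀ (ℓ , refl)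
    recentre : ∀ {u v} → StarEdge π c L u v → StarEdge π (L ℓ₀) (λ _ → c) u v
    recentre (inj₁ (u≡c , ℓ , ℓ≡v)) = inj₂ (trans (sym ℓ≡v) (only-leaf ℓ) , ℓ , sym u≡c)
    recentre (inj₂ (v≡c , ℓ , ℓ≡u)) = inj₁ (trans (sym ℓ≡u) (only-leaf ℓ) , ℓ , sym v≡c)
    uncentre : ∀ {u v} → StarEdge π (L ℓ₀) (λ _ → c) u v → StarEdge π c L u v
    uncentre (inj₁ (u≡q₀ , _ , c≡v)) = inj₂ (sym c≡v , ℓ₀ , sym u≡q₀)
    uncentre (inj₂ (v≡q₀ , _ , c≡u)) = inj₁ (sym c≡u , ℓ₀ , sym v≡q₀)
    edges′ : StarEdges π (L ℓ₀) (λ _ → c)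
    edges′ u v u≢v = proj₁ (edges u v u≢v) ∘ uncentre ,
                     λ ¬edge → proj₂ (edges u v u≢v) (¬edge ∘ recentre)

-- In a base permutation every term lies in an occurrence of 123 or 132;
-- the occurrence can be found since there are finitely many candidates.
module _ {n : ℕ} (π : Permutation′ n) where

  occurrence? : ∀ i j k → Dec (Occ123or132 π i j k)
  occurrence? i j k = i F.<? j ×-dec (j F.<? k ×-dec
    ((((π ⟨$⟩ʳ i) F.<? (π ⟨$⟩ʳ j)) ×-dec ((π ⟨$⟩ʳ j) F.<? (π ⟨$⟩ʳ k)))
     ⊎-dec (((π ⟨$⟩ʳ i) F.<? (π ⟨$⟩ʳ k)) ×-dec ((π ⟨$⟩ʳ k) F.<? (π ⟨$⟩ʳ j)))))

  occurrence-through : IsBase π → ∀ t →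
    ∃[ i ] ∃[ j ] ∃[ k ] (Occ123or132 π i j k × (t ≡ i ⊎ t ≡ j ⊎ t ≡ k))
  occurrence-through base t = decidable-stable
    (FP.any? λ i → FP.any? λ j → FP.any? λ k →
       occurrence? i j k ×-dec (t FP.≟ i ⊎-dec (t FP.≟ j ⊎-dec t FP.≟ k)))
    (base t)

-- Each leaf u has a unique
-- common out-neighbour with c, its partner; every position is c, a leaf,
-- or an out-neighbour of a leaf (a feeder, necessarily a partner); each
-- partner sits immediately before its leaf.  Reading positions from the
-- left, feeders and leaves therefore alternate up to c, which is last:
-- n = 2m + 1, the leaves are the odd positions.  Finally the relative order
-- of the values is that of the target, which pins the values down.
module LeftStarAnalysis {n : ℕ} (π : Permutation′ n) {m : ℕ} (m≥1 : 1 ≤ m)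
       (avoid : Avoids132 π) (S : LeftStar π m) (base : IsBase π) where
  open LeftStar S renaming (centre to c; leaf to L; leaf≢centre to L≢c)
  open StarFacts π avoid c L L≢c edges

  val : Fin n → ℕ
  val = value π

  c<n : toℕ c < n
  c<n = FP.toℕ<n c

  leaf-left : ∀ {u} → Leaf u → u F.< c
  leaf-left (ℓ , refl) = leaf<centre ℓ

  leaf-below-centre : ∀ {u} → Leaf u → val u < val c
  leaf-below-centre lu = leaf-left-below lu (leaf-left lu)

  partner : ∀ {u} → Leaf u → Fin n
  partner lu = proj₁ (centreOut lu)

  partner-left : ∀ {u} (lu : Leaf u) → partner lu F.< u
  partner-left lu = proj₁ (proj₂ (proj₂ (centreOut lu)))

  partner-below : ∀ {u} (lu : Leaf u) → val (partner lu) < val u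
  partner-below lu = proj₂ (proj₂ (proj₂ (centreOut lu)))

  -- any out-neighbour of a leaf is also one of c, hence is the partner
  partner-unique : ∀ {u} (lu : Leaf u) k → k F.< u → val k < val u → k ≡ partner lu
  partner-unique {u} lu k k<u ku =
    edge-commonOut-unique c u (λ c≡u → leaf≢centre lu (sym c≡u)) (inj₁ (refl , lu)) k (partner lu)
      ((<-trans k<u (leaf-left lu) , <-trans ku (leaf-below-centre lu)) , (k<u , ku))
      (proj₂ (centreOut lu))

  -- leaves decrease in value from left to right, since otherwise the
  -- partner of the left one would be a common out-neighbour of both
  leaves-descend : ∀ {a b} → Leaf a → Leaf b → a F.< b → val b < val a
  leaves-descend {a} {b} la lb a<b with <-cmp (val a) (val b)
  ... | tri> _ _ ba = ba
  ... | tri≈ _ ab _ = contradiction (value-injective π ab) (FP.<⇒≢ a<b)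
  ... | tri< ab _ _ = contradiction
          ((partner-left la , partner-below la) ,
           (<-trans (partner-left la) a<b , <-trans (partner-below la) ab))
          (leaves-unjoined la lb (FP.<⇒≢ a<b) (partner la))

  Feeder : Fin n → Set
  Feeder t = Σ (Fin n) λ u → Leaf u × t F.< u × val t < val u

  leaf-not-feeder : ∀ {p} → Leaf p → ¬ Feeder p
  leaf-not-feeder lp (u , lu , p<u , pu) = <-asym pu (leaves-descend lp lu p<u)

  -- every occurrence of 123 is (feeder, leaf, c), and there is no 132
  classify : ∀ t → t ≡ c ⊎ Leaf t ⊎ Feeder t
  classify t with occurrence-through π base t
  ... | i , j , k , (i<j , j<k , inj₂ (ik , kj)) , _ = contradiction (ik , kj) (avoid i j k i<j j<k)
  ... | i , j , k , (i<j , j<k , inj₁ (ij , jk)) , t∈ijk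
    with commonOut⇒edge j k (FP.<⇒≢ j<k) i ((i<j , ij) , (<-trans i<j j<k , <-trans ij jk))
  ...   | inj₁ (refl , lk) = contradiction j<k (<-asym (leaf-left lk))
  ...   | inj₂ (refl , lj) with t∈ijk
  ...     | inj₁ refl = inj₂ (inj₂ (j , lj , i<j , ij))
  ...     | inj₂ (inj₁ refl) = inj₂ (inj₁ lj)
  ...     | inj₂ (inj₂ refl) = inj₁ refl

  no-leaf-between : ∀ {u} (lu : Leaf u) {u′} → Leaf u′ → partner lu F.< u′ → ¬ u′ F.< u
  no-leaf-between lu lu′ p<u′ u′<u =
    avoid (partner lu) _ _ p<u′ u′<u (partner-below lu , leaves-descend lu′ lu u′<u)

  nothing-between : ∀ {u} (lu : Leaf u) t → partner lu F.< t → ¬ t F.< u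
  nothing-between {u} lu t p<t t<u with classify t
  ... | inj₁ refl = <-asym t<u (leaf-left lu)
  ... | inj₂ (inj₁ lt) = no-leaf-between lu lt p<t t<u
  ... | inj₂ (inj₂ (u′ , lu′ , t<u′ , tu′)) with FP.<-cmp u′ u
  ...   | tri< u′<u _ _ = no-leaf-between lu lu′ (<-trans p<t t<u′) u′<u
  ...   | tri≈ _ refl _ = FP.<⇒≢ p<t (sym (partner-unique lu t t<u tu′))
  ...   | tri> _ _ u<u′ = avoid t u u′ t<u u<u′ (tu′ , leaves-descend lu lu′ u<u′)

  partner-adjacent : ∀ {u} (lu : Leaf u) → toℕ u ≡ suc (toℕ (partner lu))
  partner-adjacent {u} lu with m≤n⇒m<n∨m≡n (partner-left lu)
  ... | inj₂ e = sym e
  ... | inj₁ next<u = contradiction (subst (_< toℕ u) (sym (pos-at _ next<n)) next<u)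
          (nothing-between lu (at _ next<n) (subst (toℕ (partner lu) <_) (sym (pos-at _ next<n)) (n<1+n _)))
    where next<n = <-trans next<u (FP.toℕ<n u)

  feeder-then-leaf : ∀ x .(sx<n : suc x < n) → Feeder (at x (<-trans (n<1+n x) sx<n)) → Leaf (at (suc x) sx<n)
  feeder-then-leaf x sx<n (u , lu , x<u , xu) = subst Leaf u≡sx lu
    where
      x≡partner = partner-unique lu _ x<u xu
      u≡sx : u ≡ at (suc x) sx<n
      u≡sx = FP.toℕ-injective (begin
        toℕ u                    ≡⟨ partner-adjacent lu ⟩
        suc (toℕ (partner lu))   ≡˘⟨ cong (suc ∘ toℕ) x≡partner ⟩
        suc (toℕ (at x _))       ≡⟨ cong suc (pos-at x (<-trans (n<1+n x) sx<n)) ⟩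
        suc x                    ≡˘⟨ pos-at (suc x) sx<n ⟩
        toℕ (at (suc x) sx<n)    ∎)
        where open ≡-Reasoning

  left-of-centre : ∀ x (x<c : x < toℕ c) → Leaf (at x (<-trans x<c c<n)) ⊎ Feeder (at x (<-trans x<c c<n))
  left-of-centre x x<c with classify (at x (<-trans x<c c<n))
  ... | inj₁ x≡c = contradiction (trans (sym (pos-at x (<-trans x<c c<n))) (cong toℕ x≡c)) (<⇒≢ x<c)
  ... | inj₂ r = r

  parity : ∀ x (x<c : x < toℕ c) →
    (Odd x × Leaf (at x (<-trans x<c c<n))) ⊎ (¬ Odd x × Feeder (at x (<-trans x<c c<n)))
  parity zero 0<c with left-of-centre zero 0<c
  ... | inj₂ feeder = inj₂ ((λ ()) , feeder)
  ... | inj₁ l0 = contradiction (subst (toℕ (partner l0) <_) (pos-at 0 (<-trans 0<c c<n)) (partner-left l0)) n≮0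
  parity (suc x) sx<c with parity x (<-trans (n<1+n x) sx<c)
  ... | inj₂ (even , feeder) = inj₁ (¬odd⇒odd-suc x even , feeder-then-leaf x (<-trans sx<c c<n) feeder)
  ... | inj₁ (odd , lx) with left-of-centre (suc x) sx<c
  ...   | inj₂ feeder = inj₂ (odd⇒¬odd-suc x odd , feeder)
  ...   | inj₁ lsx = contradiction
          (subst Feeder x≡partner (_ , lsx , partner-left lsx , partner-below lsx)) (leaf-not-feeder lx)
    where
      x≡partner : partner lsx ≡ at x (<-trans (<-trans (n<1+n x) sx<c) c<n)
      x≡partner = FP.toℕ-injective (suc-injective (trans (sym (partner-adjacent lsx))
        (trans (pos-at (suc x) (<-trans sx<c c<n)) (cong suc (sym (pos-at x (<-trans (<-trans (n<1+n x) sx<c) c<n)))))))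

  leaves-odd : ∀ {q} → Leaf q → Odd (toℕ q)
  leaves-odd {q} lq with parity (toℕ q) (leaf-left lq)
  ... | inj₁ (odd , _) = odd
  ... | inj₂ (_ , feeder) = contradiction (subst Feeder (at-pos q) feeder) (leaf-not-feeder lq)

  -- the position just before c holds a leaf, so c is at an even position 2a
  centre-even : Σ ℕ λ a → toℕ c ≡ dbl a
  centre-even = from-predecessor (toℕ c) refl (≤-trans (s≤s z≤n) (leaf<centre (at 0 m≥1)))
    where
      odd-before-centre : ∀ y → suc y ≡ toℕ c → Odd y
      odd-before-centre y sy≡c with parity y (subst (y <_) sy≡c (n<1+n y))
      ... | inj₁ (odd , _) = odd
      ... | inj₂ (_ , feeder) = contradiction
              (FP.toℕ-injective (trans (pos-at _ (subst (_< n) (sym sy≡c) c<n)) sy≡c))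
              (leaf≢centre (feeder-then-leaf y (subst (_< n) (sym sy≡c) c<n) feeder))
      from-predecessor : ∀ x → x ≡ toℕ c → 0 < x → Σ ℕ λ a → toℕ c ≡ dbl a
      from-predecessor (suc y) sy≡c _ =
        suc ⌊ y /2⌋ , trans (sym sy≡c) (cong suc (odd⇒dbl+1 y (odd-before-centre y sy≡c)))

  a : ℕ
  a = proj₁ centre-even

  c≡2a : toℕ c ≡ dbl a
  c≡2a = proj₂ centre-even

  below-centre-position : ∀ t → toℕ t ≤ toℕ c
  below-centre-position t with classify t
  ... | inj₁ refl = ≤-refl
  ... | inj₂ (inj₁ lt) = <⇒≤ (leaf-left lt)
  ... | inj₂ (inj₂ (u , lu , t<u , _)) = <⇒≤ (<-trans t<u (leaf-left lu))

  size : n ≡ suc (dbl a)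
  size = trans (≤-antisym n≤1+c c<n) (cong suc c≡2a)
    where
      n≤1+c : n ≤ suc (toℕ c)
      n≤1+c = ≮⇒≥ λ sc<n → 1+n≰n (subst (_≤ toℕ c) (pos-at _ sc<n) (below-centre-position (at _ sc<n)))

  -- the leaves are exactly the odd positions 2i+1 < 2a, so there are a of them
  leaf-count : m ≡ a
  leaf-count = FP.cantor-schröder-bernstein {f = half} {g = leaf-at} half-injective leaf-at-injective
    where
      half<a : ∀ ℓ → ⌊ toℕ (L ℓ) /2⌋ < a
      half<a ℓ = dbl-cancel-< (≤-trans (n≤1+n _)
        (subst₂ _<_ (odd⇒dbl+1 _ (leaves-odd (ℓ , refl))) c≡2a (leaf<centre ℓ)))
      half : Fin m → Fin a
      half ℓ = at _ (half<a ℓ)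
      half-injective : ∀ {ℓ ℓ′} → half ℓ ≡ half ℓ′ → ℓ ≡ ℓ′
      half-injective {ℓ} {ℓ′} e = leaf-injective ℓ ℓ′ (FP.toℕ-injective (begin
          toℕ (L ℓ)                    ≡⟨ odd⇒dbl+1 _ (leaves-odd (ℓ , refl)) ⟩
          suc (dbl ⌊ toℕ (L ℓ) /2⌋)    ≡⟨ cong (suc ∘ dbl) halves ⟩
          suc (dbl ⌊ toℕ (L ℓ′) /2⌋)   ≡˘⟨ odd⇒dbl+1 _ (leaves-odd (ℓ′ , refl)) ⟩
          toℕ (L ℓ′)                   ∎))
        where
          open ≡-Reasoning
          halves = trans (sym (pos-at _ (half<a ℓ))) (trans (cong toℕ e) (pos-at _ (half<a ℓ′)))
      odd<c : ∀ (i : Fin a) → suc (dbl (toℕ i)) < toℕ c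
      odd<c i = subst (suc (dbl (toℕ i)) <_) (sym c≡2a) (dbl-mono-≤ (FP.toℕ<n i))
      leaf-at-odd : ∀ (i : Fin a) → Leaf (at (suc (dbl (toℕ i))) (<-trans (odd<c i) c<n))
      leaf-at-odd i with parity (suc (dbl (toℕ i))) (odd<c i)
      ... | inj₁ (_ , leaf) = leaf
      ... | inj₂ (even , _) = contradiction (odd-dbl+1 (toℕ i)) even
      leaf-at : Fin a → Fin m
      leaf-at i = proj₁ (leaf-at-odd i)
      leaf-at-injective : ∀ {i j} → leaf-at i ≡ leaf-at j → i ≡ j
      leaf-at-injective {i} {j} e = FP.toℕ-injective (dbl-injective (suc-injective (begin
          suc (dbl (toℕ i))         ≡˘⟨ pos-at _ (<-trans (odd<c i) c<n) ⟩
          toℕ (at _ _)              ≡˘⟨ cong toℕ (proj₂ (leaf-at-odd i)) ⟩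
          toℕ (L (leaf-at i))       ≡⟨ cong (toℕ ∘ L) e ⟩
          toℕ (L (leaf-at j))       ≡⟨ cong toℕ (proj₂ (leaf-at-odd j)) ⟩
          toℕ (at _ _)              ≡⟨ pos-at _ (<-trans (odd<c j) c<n) ⟩
          suc (dbl (toℕ j))         ∎)))
        where open ≡-Reasoning

  below-centre : ∀ t → t ≢ c → val t < val c
  below-centre t t≢c with classify t
  ... | inj₁ t≡c = contradiction t≡c t≢c
  ... | inj₂ (inj₁ lt) = leaf-below-centre lt
  ... | inj₂ (inj₂ (u , lu , _ , tu)) = <-trans tu (leaf-below-centre lu)

  ascent-shape : ∀ p q → p F.< q → q ≢ c → val p < val q → Odd (toℕ q) × toℕ q ≡ suc (toℕ p)
  ascent-shape p q p<q q≢c pq with classify q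
  ... | inj₁ q≡c = contradiction q≡c q≢c
  ... | inj₂ (inj₁ lq) = leaves-odd lq ,
          trans (partner-adjacent lq) (cong (suc ∘ toℕ) (sym (partner-unique lq p p<q pq)))
  ... | inj₂ (inj₂ (u , lu , q<u , qu)) = contradiction
          (trans (partner-unique lu p (<-trans p<q q<u) (<-trans pq qu)) (sym (partner-unique lu q q<u qu)))
          (FP.<⇒≢ p<q)

  position≤2a : ∀ t → toℕ t ≤ dbl a
  position≤2a t = subst (toℕ t ≤_) c≡2a (below-centre-position t)

  order-preserved : ∀ p q → val p < val q → target a a (toℕ p) < target a a (toℕ q)
  order-preserved p q pq with FP.<-cmp p q
  ... | tri≈ _ refl _ = contradiction pq (<-irrefl refl)
  ... | tri< p<q _ _ with target-ascent a a (toℕ p) (toℕ q) ≤-refl p<q (position≤2a q)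
  ...   | inj₁ (_ , below) = below
  ...   | inj₂ (¬asc , _) with q FP.≟ c
  ...     | yes refl = contradiction (inj₁ c≡2a) ¬asc
  ...     | no q≢c = contradiction (inj₂ (ascent-shape p q p<q q≢c pq)) ¬asc
  order-preserved p q pq | tri> _ _ q<p with target-ascent a a (toℕ q) (toℕ p) ≤-refl q<p (position≤2a p)
  ... | inj₂ (_ , below) = below
  ... | inj₁ (inj₁ p-last , _) = contradiction (below-centre q (λ q≡c → FP.<⇒≢ q<p (trans q≡c (sym p≡c))))
                                               (subst (λ t → ¬ val q < val t) p≡c (<-asym pq))
    where p≡c = FP.toℕ-injective (trans p-last (sym c≡2a))
  ... | inj₁ (inj₂ (odd , p≡1+q) , _) =
        contradiction (subst (λ t → val t < val p) q≡partner (partner-below lp)) (<-asym pq)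
    where
      p<c : p F.< c
      p<c = ≤∧≢⇒< (below-centre-position p) (λ e → ¬odd-dbl a (subst Odd (trans e c≡2a) odd))
      lp : Leaf p
      lp with parity (toℕ p) p<c
      ... | inj₁ (_ , leaf) = subst Leaf (at-pos p) leaf
      ... | inj₂ (even , _) = contradiction odd even
      q≡partner : partner lp ≡ q
      q≡partner = FP.toℕ-injective (suc-injective (trans (sym (partner-adjacent lp)) p≡1+q))

  -- hence x ↦ target (π⁻¹ x) is strictly increasing, so it is the identity
  values : ∀ i → val i ≡ target a a (toℕ i)
  values i = sym (begin
      target a a (toℕ i)                ≡⟨ cong (target a a ∘ toℕ) (sym (inverseˡ π)) ⟩
      target a a (toℕ (π ⟨$⟩ˡ (π ⟨$⟩ʳ i))) ≡˘⟨ cong (λ t → target a a (toℕ (π ⟨$⟩ˡ t))) (at-pos (π ⟨$⟩ʳ i)) ⟩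
      g (val i) (FP.toℕ<n (π ⟨$⟩ʳ i))     ≡⟨ identity (val i) (FP.toℕ<n (π ⟨$⟩ʳ i)) ⟩
      val i                               ∎)
    where
      open ≡-Reasoning
      g : ∀ x → x < n → ℕ
      g x x<n = target a a (toℕ (π ⟨$⟩ˡ at x x<n))
      val-at : ∀ x (x<n : x < n) → val (π ⟨$⟩ˡ at x x<n) ≡ x
      val-at x x<n = trans (cong toℕ (inverseʳ π)) (pos-at x x<n)
      open StrictlyIncreasing n g
        (λ x x<n → subst (g x x<n <_) (sym size) (s≤s (target-≤ a a _ ≤-refl (position≤2a _))))
        (λ x y x<n y<n x<y → order-preserved _ _ (subst₂ _<_ (sym (val-at x x<n)) (sym (val-at y y<n)) x<y))

  size-m : n ≡ suc (dbl m)
  size-m = subst (λ k → n ≡ suc (dbl k)) (sym leaf-count) size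

  values-m : ∀ i → val i ≡ target m m (toℕ i)
  values-m i = subst (λ k → val i ≡ target k k (toℕ i)) (sym leaf-count) (values i)

inB⇒target : ∀ m → m ≥ 1 → ∀ {n} (π : Permutation′ n) → InB-Star132 π m → oneLine π ≡ targetPerm m
inB⇒target m m≥1 π (avoid , star , base) = values⇒oneLine m π size-m values-m
  where open LeftStarAnalysis π m≥1 avoid (orient avoid star) base

target⇒inB : ∀ m → m ≥ 1 → ∀ {n} (π : Permutation′ n) → oneLine π ≡ targetPerm m → InB-Star132 π m
target⇒inB m m≥1 π eq with oneLine-size m π eq
... | refl = TargetInB.inB m m≥1 π (oneLine⇒values m π eq)

mainTheorem11 : (m : ℕ) → m ≥ 1 → (n : ℕ) → (π : Permutation′ n) →
    InB-Star132 π m ⇔ (oneLine π ≡ targetPerm m)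
mainTheorem11 m m≥1 n π = mk⇔ (inB⇒target m m≥1 π) (target⇒inB m m≥1 π)
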